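{- Let $\widetilde\Delta$ be a connected graph, $N$ a group, and $\ell$ a reductive voltage assignment on $\widetilde\Delta$ with values in $N$. Let $\widetilde\Gamma$ be the lift of $\widetilde\Delta$ with respect to $\ell$ and $\Gamma=\widetilde\Gamma/\sim$. Let $G$ be a group of automorphisms of $\widetilde\Delta$ acting on $N$ by group automorphisms such that $\ell$ is $G$-equivariant. Then $G\ltimes N$ has an action on $\Gamma$ defined by $([v],n)^{(g,k)}=([v]^g,n^gk)$.
   Context: Groups act on the right. Graphs are simple; $\perp$ denotes adjacency; a dart is an ordered pair of adjacent vertices. A voltage assignment is a map $\ell$ from darts to $N$ with $\ell(u,v)=\ell(v,u)^{ -1}$; the lift has vertex set $V\times N$ with $(u,m)\perp(v,n)$ iff $u\perp v$ and $\ell(u,v)=mn^{ -1}$. In a graph, $x\sim y$ iff $x,y$ have the same neighbours; the reduct $\Gamma=\widetilde\Gamma/\sim$ has the $\sim$-classes as vertices, adjacent iff representatives are. $\ell$ is reductive if for all $u\sim v\perp w$ one has $\ell(w,u)=\ell(w,v)$; in that case the class of $(v,n)$ in $\widetilde\Gamma$ is written $([v],n)$, $[v]$ the class of $v$ in $\widetilde\Delta$. $\ell$ is $G$-equivariant if $\ell(u^g,w^g)=\ell(u,w)^g$. The semidirect product has multiplication $(g,k)(h,j)=(gh,k^hj)$. -}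

module Defs where

open import Level using (Level; _⊔_)
open import Algebra.Bundles using (Group)
open import Data.Product using (_×_; _,_)
open import Function.Bundles using (_⇔_)
open import Relation.Binary.PropositionalEquality using (_≡_)
open import Relation.Binary.Construct.Closure.ReflexiveTransitive using (Star)
open import Relation.Nullary using (¬_)

private variable a b c ℓ c₁ ℓ₁ : Level

record IsSimpleGraph {V : Set a} (_⊥_ : V → V → Set b) : Set (a ⊔ b) where
  field
    ⊥-sym    : ∀ {u v} → u ⊥ v → v ⊥ u
    ⊥-irrefl : ∀ {u} → ¬ (u ⊥ u)

Connected : {V : Set a} (_⊥_ : V → V → Set b) → Set (a ⊔ b)
Connected _⊥_ = ∀ u v → Star _⊥_ u v

SameNbrs : {V : Set a} (_⊥_ : V → V → Set b) → V → V → Set (a ⊔ b)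
SameNbrs _⊥_ x y = ∀ w → (x ⊥ w) ⇔ (y ⊥ w)

module _ (N : Group c ℓ) where
  open Group N renaming (Carrier to ∣N∣)

  -- Voltage assignment: vol u v is the voltage of the dart (u,v)
  -- (values on non-adjacent pairs are irrelevant).
  IsVoltage : {V : Set a} (_⊥_ : V → V → Set b) → (V → V → ∣N∣) → Set (a ⊔ b ⊔ ℓ)
  IsVoltage _⊥_ vol = ∀ {u v} → u ⊥ v → vol u v ≈ (vol v u) ⁻¹

  Reductive : {V : Set a} (_⊥_ : V → V → Set b) → (V → V → ∣N∣) → Set (a ⊔ b ⊔ ℓ)
  Reductive _⊥_ vol = ∀ {u v w} → SameNbrs _⊥_ u v → v ⊥ w → vol w u ≈ vol w v

  LiftAdj : {V : Set a} (_⊥_ : V → V → Set b) → (V → V → ∣N∣) →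
            V × ∣N∣ → V × ∣N∣ → Set (b ⊔ ℓ)
  LiftAdj _⊥_ vol (u , m) (v , n) = (u ⊥ v) × (vol u v ≈ m ∙ n ⁻¹)

module _ (G : Group c ℓ) where
  open Group G renaming (Carrier to ∣G∣)

  record IsAutGroupOf {V : Set a} (_⊥_ : V → V → Set b) (act : V → ∣G∣ → V)
         : Set (a ⊔ b ⊔ c ⊔ ℓ) where
    field
      act-ε     : ∀ v → act v ε ≡ v
      act-∙     : ∀ v g h → act v (g ∙ h) ≡ act (act v g) h
      act-cong  : ∀ v {g h} → g ≈ h → act v g ≡ act v h
      act-adj   : ∀ u v g → (u ⊥ v) ⇔ (act u g ⊥ act v g)
      faithful  : ∀ g → (∀ v → act v g ≡ v) → g ≈ ε

module _ (G : Group c ℓ) (N : Group c₁ ℓ₁) where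
  private
    module G = Group G
    module N = Group N

  record IsGroupAutAction (φ : N.Carrier → G.Carrier → N.Carrier)
         : Set (c ⊔ ℓ ⊔ c₁ ⊔ ℓ₁) where
    field
      φ-ε    : ∀ n → φ n G.ε N.≈ n
      φ-∙    : ∀ n g h → φ n (g G.∙ h) N.≈ φ (φ n g) h
      φ-cong : ∀ {m n g h} → m N.≈ n → g G.≈ h → φ m g N.≈ φ n h
      φ-hom  : ∀ m n g → φ (m N.∙ n) g N.≈ (φ m g N.∙ φ n g)

  Equivariant : {V : Set a} (_⊥_ : V → V → Set b) → (V → V → N.Carrier) →
                (V → G.Carrier → V) → (N.Carrier → G.Carrier → N.Carrier) →
                Set (a ⊔ b ⊔ c ⊔ ℓ₁)
  Equivariant _⊥_ vol act φ =
    ∀ {u w} g → u ⊥ w → vol (act u g) (act w g) N.≈ φ (vol u w) g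

  _≈⋉_ : G.Carrier × N.Carrier → G.Carrier × N.Carrier → Set (ℓ ⊔ ℓ₁)
  (g , k) ≈⋉ (h , j) = (g G.≈ h) × (k N.≈ j)

  ε⋉ : G.Carrier × N.Carrier
  ε⋉ = G.ε , N.ε

  mul⋉ : (N.Carrier → G.Carrier → N.Carrier) →
         G.Carrier × N.Carrier → G.Carrier × N.Carrier → G.Carrier × N.Carrier
  mul⋉ φ (g , k) (h , j) = (g G.∙ h) , (φ k h N.∙ j)

  liftAct : {V : Set a} → (V → G.Carrier → V) → (N.Carrier → G.Carrier → N.Carrier) →
            V × N.Carrier → G.Carrier × N.Carrier → V × N.Carrier
  liftAct act φ (v , n) (g , k) = act v g , (φ n g N.∙ k)

  -- "G ⋉ N acts on Γ = Γ̃/∼ by ([v],n)^(g,k) = ([v]^g, n^g k)":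
  -- vertices of Γ are ∼-classes of vertices of Γ̃ (∼ = same neighbours in Γ̃),
  -- adjacency of classes is adjacency of representatives.
  record IsActionOnReduct {V : Set a} (_⊥_ : V → V → Set b) (vol : V → V → N.Carrier)
         (act : V → G.Carrier → V) (φ : N.Carrier → G.Carrier → N.Carrier)
         : Set (a ⊔ b ⊔ c ⊔ ℓ ⊔ c₁ ⊔ ℓ₁) where
    _⊥̃_ = LiftAdj N _⊥_ vol
    _∼_ = SameNbrs _⊥̃_
    _·_ = liftAct act φ
    field
      well-defined : ∀ {x y} s → x ∼ y → (x · s) ∼ (y · s)
      act-cong     : ∀ x {s t} → s ≈⋉ t → (x · s) ∼ (x · t)
      act-id       : ∀ x → (x · ε⋉) ∼ x
      act-comp     : ∀ x s t → (x · mul⋉ φ s t) ∼ ((x · s) · t)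
      act-adj      : ∀ x y s → (x ⊥̃ y) ⇔ ((x · s) ⊥̃ (y · s))

{-# OPTIONS --safe #-}
module Submission where

open import Defs
open import Level using (Level; _⊔_)
open import Algebra.Bundles using (Group)
open import Data.Product using (Σ; _×_; _,_; proj₁; proj₂)
open import Data.Product.Relation.Binary.Pointwise.NonDependent using (×-setoid)
open import Function.Bundles using (_⇔_; mk⇔; Equivalence)
open import Relation.Binary.Bundles using (Setoid)
open import Relation.Binary.Core using (Rel)
open import Relation.Binary.Definitions using (Symmetric; _Respects₂_; _Respectsʳ_; _Respectsˡ_)
import Relation.Binary.PropositionalEquality as ≡
import Algebra.Properties.Group as GroupProperties
import Relation.Binary.Reasoning.Setoid as SetoidReasoning

-- Every (g , k) moves the lift Γ̃ by an automorphism: adjacency is preserved by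
-- equivariance of the voltages, and reflected because (g , k) has an inverse in
-- G ⋉ N.  A graph automorphism maps vertices with equal neighbourhoods to
-- vertices with equal neighbourhoods, so the action descends to Γ = Γ̃/∼.

module SameNbrsProperties {a b ℓ} {X : Set a} {_≈_ : Rel X ℓ} {_⊥_ : Rel X b}
             (≈-sym : Symmetric _≈_) (⊥-resp-≈ : _⊥_ Respects₂ _≈_) where

  open Equivalence

  private
    ⊥-respʳ : _⊥_ Respectsʳ _≈_
    ⊥-respʳ = proj₁ ⊥-resp-≈

    ⊥-respˡ : _⊥_ Respectsˡ _≈_
    ⊥-respˡ = proj₂ ⊥-resp-≈

  SameNbrs-sym : ∀ {x y} → SameNbrs _⊥_ x y → SameNbrs _⊥_ y x
  SameNbrs-sym x∼y w = mk⇔ (from (x∼y w)) (to (x∼y w))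

  ≈⇒SameNbrs : ∀ {x y} → x ≈ y → SameNbrs _⊥_ x y
  ≈⇒SameNbrs x≈y w = mk⇔ (⊥-respˡ x≈y) (⊥-respˡ (≈-sym x≈y))

  automorphism-preserves-SameNbrs : (f : X → X) →
    (∀ x y → (x ⊥ y) ⇔ (f x ⊥ f y)) → (∀ w → Σ X λ z → f z ≈ w) →
    ∀ {x y} → SameNbrs _⊥_ x y → SameNbrs _⊥_ (f x) (f y)
  automorphism-preserves-SameNbrs f f-adj f-surj x∼y w =
    mk⇔ (transport x∼y) (transport (SameNbrs-sym x∼y))
    where
    transport : ∀ {x y} → SameNbrs _⊥_ x y → f x ⊥ w → f y ⊥ w
    transport {x} {y} x∼y fx⊥w with (z , fz≈w) ← f-surj w =
      ⊥-respʳ fz≈w (to (f-adj y z) (to (x∼y z) (from (f-adj x z) (⊥-respʳ (≈-sym fz≈w) fx⊥w))))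

module GroupDivision {c ℓ} (N : Group c ℓ) where

  open Group N
  open GroupProperties N using (⁻¹-anti-homo-∙)
  open SetoidReasoning setoid

  //-cancelʳ : ∀ x y k → (x ∙ k) // (y ∙ k) ≈ x // y
  //-cancelʳ x y k = begin
    (x ∙ k) ∙ (y ∙ k) ⁻¹     ≈⟨ ∙-congˡ (⁻¹-anti-homo-∙ y k) ⟩
    (x ∙ k) ∙ (k ⁻¹ ∙ y ⁻¹)  ≈⟨ assoc x k _ ⟩
    x ∙ (k ∙ (k ⁻¹ ∙ y ⁻¹))  ≈⟨ ∙-congˡ (assoc k (k ⁻¹) _) ⟨
    x ∙ ((k ∙ k ⁻¹) ∙ y ⁻¹)  ≈⟨ ∙-congˡ (∙-congʳ (inverseʳ k)) ⟩
    x ∙ (ε ∙ y ⁻¹)           ≈⟨ ∙-congˡ (identityˡ _) ⟩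
    x ∙ y ⁻¹                 ∎

module AutActionProperties {c ℓ c₁ ℓ₁} (G : Group c ℓ) (N : Group c₁ ℓ₁)
       {φ : Group.Carrier N → Group.Carrier G → Group.Carrier N}
       (isφ : IsGroupAutAction G N φ) where

  private
    module G = Group G
    module N = Group N
  open IsGroupAutAction isφ
  open GroupProperties N using (identityˡ-unique; inverseʳ-unique)
  open SetoidReasoning N.setoid

  φ-ε-homo : ∀ g → φ N.ε g N.≈ N.ε
  φ-ε-homo g = identityˡ-unique (φ N.ε g) (φ N.ε g) (begin
    φ N.ε g N.∙ φ N.ε g  ≈⟨ φ-hom N.ε N.ε g ⟨
    φ (N.ε N.∙ N.ε) g    ≈⟨ φ-cong (N.identityˡ N.ε) G.refl ⟩
    φ N.ε g              ∎)

  φ-⁻¹-homo : ∀ n g → φ (n N.⁻¹) g N.≈ φ n g N.⁻¹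
  φ-⁻¹-homo n g = inverseʳ-unique (φ n g) (φ (n N.⁻¹) g) (begin
    φ n g N.∙ φ (n N.⁻¹) g  ≈⟨ φ-hom n (n N.⁻¹) g ⟨
    φ (n N.∙ n N.⁻¹) g      ≈⟨ φ-cong (N.inverseʳ n) G.refl ⟩
    φ N.ε g                 ≈⟨ φ-ε-homo g ⟩
    N.ε                     ∎)

  φ-//-homo : ∀ m n g → φ (m N.// n) g N.≈ φ m g N.// φ n g
  φ-//-homo m n g = N.trans (φ-hom m (n N.⁻¹) g) (N.∙-congˡ (φ-⁻¹-homo n g))

  _⁻¹⋉ : G.Carrier × N.Carrier → G.Carrier × N.Carrier
  (g , k) ⁻¹⋉ = g G.⁻¹ , φ (k N.⁻¹) (g G.⁻¹)

  ⋉-inverseʳ : ∀ s → _≈⋉_ G N (mul⋉ G N φ s (s ⁻¹⋉)) (ε⋉ G N)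
  ⋉-inverseʳ (g , k) = G.inverseʳ g , (begin
    φ k (g G.⁻¹) N.∙ φ (k N.⁻¹) (g G.⁻¹)  ≈⟨ φ-hom k (k N.⁻¹) (g G.⁻¹) ⟨
    φ (k N.∙ k N.⁻¹) (g G.⁻¹)             ≈⟨ φ-cong (N.inverseʳ k) G.refl ⟩
    φ N.ε (g G.⁻¹)                        ≈⟨ φ-ε-homo (g G.⁻¹) ⟩
    N.ε                                   ∎)

  ⋉-inverseˡ : ∀ s → _≈⋉_ G N (mul⋉ G N φ (s ⁻¹⋉) s) (ε⋉ G N)
  ⋉-inverseˡ (g , k) = G.inverseˡ g , (begin
    φ (φ (k N.⁻¹) (g G.⁻¹)) g N.∙ k  ≈⟨ N.∙-congʳ (φ-∙ (k N.⁻¹) (g G.⁻¹) g) ⟨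
    φ (k N.⁻¹) (g G.⁻¹ G.∙ g) N.∙ k  ≈⟨ N.∙-congʳ (φ-cong N.refl (G.inverseˡ g)) ⟩
    φ (k N.⁻¹) G.ε N.∙ k             ≈⟨ N.∙-congʳ (φ-ε (k N.⁻¹)) ⟩
    k N.⁻¹ N.∙ k                     ≈⟨ N.inverseˡ k ⟩
    N.ε                              ∎)

module LiftAdjacency {a b c₁ ℓ₁} {V : Set a} (_⊥_ : V → V → Set b)
       (N : Group c₁ ℓ₁) (vol : V → V → Group.Carrier N) where

  private module N = Group N
  open GroupProperties N using (//-cong₂)

  vertexSetoid : Setoid (a ⊔ c₁) (a ⊔ ℓ₁)
  vertexSetoid = ×-setoid (≡.setoid V) N.setoid

  open Setoid vertexSetoid public using () renaming (_≈_ to _≋_)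

  LiftAdj-resp-≋ : LiftAdj N _⊥_ vol Respects₂ _≋_
  LiftAdj-resp-≋ = (λ { (≡.refl , n≈n') (u⊥v , eq) → u⊥v , N.trans eq (//-cong₂ N.refl n≈n') })
                 , (λ { (≡.refl , m≈m') (u⊥v , eq) → u⊥v , N.trans eq (//-cong₂ m≈m' N.refl) })

module LiftAction {a b c ℓ c₁ ℓ₁} {V : Set a} (_⊥_ : V → V → Set b)
       (N : Group c₁ ℓ₁) (vol : V → V → Group.Carrier N)
       (G : Group c ℓ) {act : V → Group.Carrier G → V}
       {φ : Group.Carrier N → Group.Carrier G → Group.Carrier N}
       (isAut : IsAutGroupOf G _⊥_ act) (isφ : IsGroupAutAction G N φ) where

  private
    module G = Group G
    module N = Group N
  open IsAutGroupOf isAut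
  open IsGroupAutAction isφ
  open AutActionProperties G N isφ
  open GroupDivision N
  open LiftAdjacency _⊥_ N vol
  open SameNbrsProperties (Setoid.sym vertexSetoid) LiftAdj-resp-≋ public
  open Equivalence

  _⊥̃_ : Rel (V × N.Carrier) (b ⊔ ℓ₁)
  _⊥̃_ = LiftAdj N _⊥_ vol

  _·_ : V × N.Carrier → G.Carrier × N.Carrier → V × N.Carrier
  _·_ = liftAct G N act φ

  _⋆_ : G.Carrier × N.Carrier → G.Carrier × N.Carrier → G.Carrier × N.Carrier
  _⋆_ = mul⋉ G N φ

  liftAct-cong : ∀ x {s t} → _≈⋉_ G N s t → (x · s) ≋ (x · t)
  liftAct-cong (v , n) (g≈h , k≈j) = act-cong v g≈h , N.∙-cong (φ-cong N.refl g≈h) k≈j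

  liftAct-identity : ∀ x → (x · ε⋉ G N) ≋ x
  liftAct-identity (v , n) = act-ε v , N.trans (N.identityʳ _) (φ-ε n)

  liftAct-∙ : ∀ x s t → (x · (s ⋆ t)) ≋ ((x · s) · t)
  liftAct-∙ (v , n) (g , k) (h , j) = act-∙ v g h , (begin
    φ n (g G.∙ h) N.∙ (φ k h N.∙ j)  ≈⟨ N.∙-congʳ (φ-∙ n g h) ⟩
    φ (φ n g) h N.∙ (φ k h N.∙ j)    ≈⟨ N.assoc _ _ j ⟨
    (φ (φ n g) h N.∙ φ k h) N.∙ j    ≈⟨ N.∙-congʳ (φ-hom _ k h) ⟨
    φ (φ n g N.∙ k) h N.∙ j          ∎)
    where open SetoidReasoning N.setoid

  liftAct-inverse : ∀ x {s t} → _≈⋉_ G N (s ⋆ t) (ε⋉ G N) → ((x · s) · t) ≋ x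
  liftAct-inverse x {s} {t} st≈ε = begin
    (x · s) · t  ≈⟨ liftAct-∙ x s t ⟨
    x · (s ⋆ t)  ≈⟨ liftAct-cong x st≈ε ⟩
    x · ε⋉ G N   ≈⟨ liftAct-identity x ⟩
    x            ∎
    where open SetoidReasoning vertexSetoid

  module _ (eqv : Equivariant G N _⊥_ vol act φ) where

    liftAct-preserves-adj : ∀ {x y} s → x ⊥̃ y → (x · s) ⊥̃ (y · s)
    liftAct-preserves-adj {u , m} {v , n} (g , k) (u⊥v , eq) = to (act-adj u v g) u⊥v , (begin
      vol (act u g) (act v g)           ≈⟨ eqv g u⊥v ⟩
      φ (vol u v) g                     ≈⟨ φ-cong eq G.refl ⟩
      φ (m N.// n) g                    ≈⟨ φ-//-homo m n g ⟩
      φ m g N.// φ n g                  ≈⟨ //-cancelʳ _ _ k ⟨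
      (φ m g N.∙ k) N.// (φ n g N.∙ k)  ∎)
      where open SetoidReasoning N.setoid

    liftAct-adj : ∀ x y s → (x ⊥̃ y) ⇔ ((x · s) ⊥̃ (y · s))
    liftAct-adj x y s = mk⇔ (liftAct-preserves-adj s) λ xs⊥ys →
      proj₁ LiftAdj-resp-≋ (liftAct-inverse y (⋉-inverseʳ s))
        (proj₂ LiftAdj-resp-≋ (liftAct-inverse x (⋉-inverseʳ s))
          (liftAct-preserves-adj (s ⁻¹⋉) xs⊥ys))

    liftAct-preserves-SameNbrs : ∀ {x y} s → SameNbrs _⊥̃_ x y → SameNbrs _⊥̃_ (x · s) (y · s)
    liftAct-preserves-SameNbrs s =
      automorphism-preserves-SameNbrs (_· s)
        (λ x y → liftAct-adj x y s) (λ w → w · (s ⁻¹⋉) , liftAct-inverse w (⋉-inverseˡ s))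

corollary2p6 : ∀ {a b c ℓ c₁ ℓ₁ : Level} {V : Set a} (_⊥_ : V → V → Set b)
    (N : Group c₁ ℓ₁) (vol : V → V → Group.Carrier N)
    (G : Group c ℓ) (act : V → Group.Carrier G → V)
    (φ : Group.Carrier N → Group.Carrier G → Group.Carrier N) →
    IsSimpleGraph _⊥_ → Connected _⊥_ →
    IsVoltage N _⊥_ vol → Reductive N _⊥_ vol →
    IsAutGroupOf G _⊥_ act → IsGroupAutAction G N φ →
    Equivariant G N _⊥_ vol act φ →
    IsActionOnReduct G N _⊥_ vol act φ
corollary2p6 _⊥_ N vol G act φ _ _ _ _ isAut isφ eqv = record
  { well-defined = liftAct-preserves-SameNbrs eqv
  ; act-cong     = λ x s≈t → ≈⇒SameNbrs (liftAct-cong x s≈t)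
  ; act-id       = λ x → ≈⇒SameNbrs (liftAct-identity x)
  ; act-comp     = λ x s t → ≈⇒SameNbrs (liftAct-∙ x s t)
  ; act-adj      = liftAct-adj eqv
  }
  where
  open LiftAction _⊥_ N vol G isAut isφ
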